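{- Let $\mathbf{L}=\langle L,\leq\rangle$ be a complete algebraic lattice with $K$ its set of compact elements, let $S$ be a compact $L$-parameterization, and let $\Sigma$ be a set of formulas. For all $a,b\in K$: $\Sigma\vdash a\Rightarrow b$ if and only if $b\leq C_\Sigma(a)$.
   Context: An isotone Galois connection in $\mathbf{L}$ is a pair $\langle f,h\rangle$ of maps $L\to L$ with $f(a)\leq b$ iff $a\leq h(b)$. An $L$-parameterization is a set $S$ of isotone Galois connections in $\mathbf{L}$ containing $\langle \mathrm{id},\mathrm{id}\rangle$; it is compact if $f(a)\in K$ for all $a\in K$ and $\langle f,h\rangle\in S$. A formula is a pair $\langle a,b\rangle\in K\times K$ written $a\Rightarrow b$. The $S$-inference system consists of the rules, for all $a,b,c,d\in K$ and $\langle f,h\rangle\in S$: (1) infer $a\vee b\Rightarrow b$ (no premises); (2) from $a\Rightarrow b$ and $b\vee c\Rightarrow d$ infer $a\vee c\Rightarrow d$; (3) from $a\Rightarrow b$ infer $f(a)\Rightarrow f(b)$. $\Sigma\vdash a\Rightarrow b$ means there is a finite sequence of formulas ending in $a\Rightarrow b$ each of which belongs to $\Sigma$ or results from earlier ones by one application of a rule. $C_\Sigma(a)=\bigvee\{b\in K;\ \Sigma\vdash c\Rightarrow b$ for some $c\in K$ with $c\leq a\}$ for $a\in L$. -}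

module Defs where

open import Level using (Level; suc; _⊔_)
open import Data.Product using (Σ; ∃; _×_; _,_)
open import Data.Sum using (_⊎_)
open import Data.List using (List)
open import Data.List.Relation.Unary.All using (All)
open import Data.List.Membership.Propositional using (_∈_)
open import Relation.Unary using (Pred)
open import Relation.Binary.PropositionalEquality using (_≡_)
open import Relation.Binary.Structures using (IsPartialOrder)
open import Function.Bundles using (_⇔_)
open import Function using (id)

record CompleteLattice (ℓ : Level) : Set (suc ℓ) where
  field
    Carrier        : Set ℓ
    _≤_            : Carrier → Carrier → Set ℓ
    isPartialOrder : IsPartialOrder _≡_ _≤_
    ⋁              : Pred Carrier ℓ → Carrier
    ⋁-upper        : (X : Pred Carrier ℓ) → ∀ {x} → X x → x ≤ ⋁ X
    ⋁-least        : (X : Pred Carrier ℓ) → ∀ u → (∀ {x} → X x → x ≤ u) → ⋁ X ≤ u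

module _ {ℓ : Level} (𝐋 : CompleteLattice ℓ) where
  open CompleteLattice 𝐋

  _∨_ : Carrier → Carrier → Carrier
  a ∨ b = ⋁ (λ x → x ≡ a ⊎ x ≡ b)

  ⋁-list : List Carrier → Carrier
  ⋁-list ys = ⋁ (λ x → x ∈ ys)

  IsCompact : Carrier → Set (suc ℓ)
  IsCompact a = (X : Pred Carrier ℓ) → a ≤ ⋁ X →
                ∃ λ (ys : List Carrier) → All X ys × a ≤ ⋁-list ys

  IsAlgebraic : Set (suc ℓ)
  IsAlgebraic = (a : Carrier) → ∃ λ (X : Pred Carrier ℓ) →
                  (∀ {x} → X x → IsCompact x) × a ≡ ⋁ X

  IsGaloisConnection : (Carrier → Carrier) → (Carrier → Carrier) → Set ℓ
  IsGaloisConnection f h = ∀ a b → (f a ≤ b) ⇔ (a ≤ h b)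

  Maps² : Set ℓ
  Maps² = (Carrier → Carrier) × (Carrier → Carrier)

  IsParameterization : Pred Maps² ℓ → Set ℓ
  IsParameterization S =
    (∀ {f h} → S (f , h) → IsGaloisConnection f h) × S (id , id)

  IsCompactParameterization : Pred Carrier ℓ → Pred Maps² ℓ → Set ℓ
  IsCompactParameterization K S =
    IsParameterization S × (∀ {f h} → S (f , h) → ∀ a → K a → K (f a))

  -- Σ ⊢ a ⇒ b  (derivability in the S-inference system; K = compact elements)
  data Derives (K : Pred Carrier ℓ) (S : Pred Maps² ℓ)
               (Σ' : Pred (Carrier × Carrier) ℓ) : Carrier → Carrier → Set ℓ where
    hyp  : ∀ {a b} → Σ' (a , b) → Derives K S Σ' a b
    rule1 : ∀ {a b} → K a → K b → Derives K S Σ' (a ∨ b) b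
    rule2 : ∀ {a b c d} → K a → K b → K c → K d →
            Derives K S Σ' a b → Derives K S Σ' (b ∨ c) d →
            Derives K S Σ' (a ∨ c) d
    rule3 : ∀ {f h a b} → S (f , h) → K a → K b →
            Derives K S Σ' a b → Derives K S Σ' (f a) (f b)

  C : (K : Pred Carrier ℓ) (S : Pred Maps² ℓ)
      (Σ' : Pred (Carrier × Carrier) ℓ) → Carrier → Carrier
  C K S Σ' a = ⋁ (λ b → K b × ∃ λ c → K c × c ≤ a × Derives K S Σ' c b)

module Submission where

-- Soundness is immediate, since C_Σ(a) is the join of the formulas derivable from compact c ≤ a.
-- Conversely, if b ≤ C_Σ(a) with b compact, then b lies below a finite join b₁ ∨ … ∨ bₙ of
-- such consequences. Each bᵢ is derivable from a (weaken a to cᵢ, then apply cᵢ ⇒ bᵢ), the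
-- derived union rule gives a ⇒ b₁ ∨ … ∨ bₙ, and weakening to b finishes. Only rules (1) and (2)
-- and the closure of K under finite joins are needed.

open import Level using (Level)
open import Data.Product using (_×_; _,_; ∃; proj₁)
open import Data.Sum using (inj₁; inj₂)
open import Data.List using (List; []; _∷_; _++_)
open import Data.List.Relation.Unary.All using (All; []; _∷_) renaming (map to All-map)
open import Data.List.Relation.Unary.All.Properties using (++⁺)
open import Data.List.Relation.Unary.Any using (here; there)
open import Data.List.Membership.Propositional using (_∈_)
open import Data.List.Membership.Propositional.Properties using (∈-++⁺ˡ; ∈-++⁺ʳ)
open import Relation.Unary using (Pred)
open import Relation.Binary.PropositionalEquality using (_≡_; refl; subst; subst₂; sym)
open import Relation.Binary.Structures using (IsPartialOrder)
open import Function.Bundles using (_⇔_; mk⇔; Equivalence)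
open import Defs hiding (_∨_; ⋁-list)
import Defs

module JoinProperties {ℓ : Level} (𝐋 : CompleteLattice ℓ) where
  open CompleteLattice 𝐋
  open IsPartialOrder isPartialOrder renaming (refl to ≤-refl; trans to ≤-trans)

  infixl 30 _∨_
  _∨_ : Carrier → Carrier → Carrier
  _∨_ = Defs._∨_ 𝐋

  ⋁-list : List Carrier → Carrier
  ⋁-list = Defs.⋁-list 𝐋

  x≤x∨y : ∀ {x y} → x ≤ x ∨ y
  x≤x∨y = ⋁-upper _ (inj₁ refl)

  y≤x∨y : ∀ {x y} → y ≤ x ∨ y
  y≤x∨y = ⋁-upper _ (inj₂ refl)

  ∨-least : ∀ {x y u} → x ≤ u → y ≤ u → x ∨ y ≤ u
  ∨-least {u = u} x≤u y≤u = ⋁-least _ u λ { (inj₁ refl) → x≤u ; (inj₂ refl) → y≤u }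

  ∨-comm : ∀ x y → x ∨ y ≡ y ∨ x
  ∨-comm _ _ = antisym (∨-least y≤x∨y x≤x∨y) (∨-least y≤x∨y x≤x∨y)

  ∨-idem : ∀ x → x ∨ x ≡ x
  ∨-idem _ = antisym (∨-least ≤-refl ≤-refl) x≤x∨y

  y≤x⇒x∨y≡x : ∀ {x y} → y ≤ x → x ∨ y ≡ x
  y≤x⇒x∨y≡x y≤x = antisym (∨-least ≤-refl y≤x) x≤x∨y

  ⋁-list-mono : ∀ {xs ys} → (∀ {x} → x ∈ xs → x ∈ ys) → ⋁-list xs ≤ ⋁-list ys
  ⋁-list-mono {ys = ys} xs⊆ys = ⋁-least _ (⋁-list ys) λ x∈xs → ⋁-upper _ (xs⊆ys x∈xs)

  ⋁-list-[]-least : ∀ {u} → ⋁-list [] ≤ u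
  ⋁-list-[]-least {u} = ⋁-least _ u λ ()

  ⋁-list-∷ : ∀ y ys → ⋁-list (y ∷ ys) ≡ y ∨ ⋁-list ys
  ⋁-list-∷ y ys = antisym
    (⋁-least _ _ λ { (here refl) → x≤x∨y ; (there y∈ys) → ≤-trans (⋁-upper _ y∈ys) y≤x∨y })
    (∨-least (⋁-upper _ (here refl)) (⋁-list-mono there))

module CompactElements {ℓ : Level} (𝐋 : CompleteLattice ℓ) where
  open CompleteLattice 𝐋
  open IsPartialOrder isPartialOrder renaming (refl to ≤-refl; trans to ≤-trans)
  open JoinProperties 𝐋

  compact-⋁-list-[] : IsCompact 𝐋 (⋁-list [])
  compact-⋁-list-[] _ _ = [] , [] , ≤-refl

  compact-∨ : ∀ {x y} → IsCompact 𝐋 x → IsCompact 𝐋 y → IsCompact 𝐋 (x ∨ y)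
  compact-∨ x-compact y-compact X x∨y≤⋁X =
    let xs , xs⊆X , x≤⋁xs = x-compact X (≤-trans x≤x∨y x∨y≤⋁X)
        ys , ys⊆X , y≤⋁ys = y-compact X (≤-trans y≤x∨y x∨y≤⋁X)
    in xs ++ ys , ++⁺ xs⊆X ys⊆X ,
       ∨-least (≤-trans x≤⋁xs (⋁-list-mono ∈-++⁺ˡ))
               (≤-trans y≤⋁ys (⋁-list-mono (∈-++⁺ʳ xs)))

module DerivedRules {ℓ : Level} (𝐋 : CompleteLattice ℓ)
  (K : Pred (CompleteLattice.Carrier 𝐋) ℓ) (S : Pred (Maps² 𝐋) ℓ)
  (Σ' : Pred (CompleteLattice.Carrier 𝐋 × CompleteLattice.Carrier 𝐋) ℓ) where
  open CompleteLattice 𝐋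
  open JoinProperties 𝐋

  infix 4 _⇒_
  _⇒_ : Carrier → Carrier → Set ℓ
  _⇒_ = Derives 𝐋 K S Σ'

  ⇒-weaken : ∀ {a c} → K a → K c → c ≤ a → a ⇒ c
  ⇒-weaken ka kc c≤a = subst (_⇒ _) (y≤x⇒x∨y≡x c≤a) (rule1 ka kc)

  ⇒-refl : ∀ {a} → K a → a ⇒ a
  ⇒-refl ka = subst (_⇒ _) (∨-idem _) (rule1 ka ka)

  ⇒-trans : ∀ {a b d} → K a → K b → K d → a ⇒ b → b ⇒ d → a ⇒ d
  ⇒-trans {a} {b} {d} ka kb kd a⇒b b⇒d =
    subst (_⇒ d) (∨-idem a) (rule2 ka kb ka kd a⇒b b∨a⇒d)
    where
    b∨a⇒d : b ∨ a ⇒ d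
    b∨a⇒d = rule2 kb kd ka kd b⇒d (subst (_⇒ d) (∨-comm a d) (rule1 ka kd))

  module _ (K-⊥ : K (⋁-list [])) (K-∨ : ∀ {x y} → K x → K y → K (x ∨ y)) where

    K-⋁-list : ∀ {ys} → All K ys → K (⋁-list ys)
    K-⋁-list [] = K-⊥
    K-⋁-list {y ∷ ys} (ky ∷ kys) = subst K (sym (⋁-list-∷ y ys)) (K-∨ ky (K-⋁-list kys))

    ⇒-∨ : ∀ {a b c} → K a → K b → K c → a ⇒ b → a ⇒ c → a ⇒ b ∨ c
    ⇒-∨ {a} {b} {c} ka kb kc a⇒b a⇒c = ⇒-trans ka (K-∨ ka kc) kb∨c a⇒a∨c a∨c⇒b∨c
      where
      kb∨c : K (b ∨ c)
      kb∨c = K-∨ kb kc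
      a∨c⇒b∨c : a ∨ c ⇒ b ∨ c
      a∨c⇒b∨c = rule2 ka kb kc kb∨c a⇒b (⇒-refl kb∨c)
      a⇒a∨c : a ⇒ a ∨ c
      a⇒a∨c = subst₂ _⇒_ (∨-idem a) (∨-comm c a)
                (rule2 ka kc ka (K-∨ kc ka) a⇒c (⇒-refl (K-∨ kc ka)))

    ⇒-⋁-list : ∀ {a ys} → K a → All (λ y → K y × a ⇒ y) ys → a ⇒ ⋁-list ys
    ⇒-⋁-list ka [] = ⇒-weaken ka K-⊥ ⋁-list-[]-least
    ⇒-⋁-list {ys = y ∷ ys} ka ((ky , a⇒y) ∷ a⇒ys) =
      subst (_ ⇒_) (sym (⋁-list-∷ y ys))
        (⇒-∨ ka ky (K-⋁-list (All-map proj₁ a⇒ys)) a⇒y (⇒-⋁-list ka a⇒ys))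

theorem16 : {ℓ : Level} (𝐋 : CompleteLattice ℓ) → IsAlgebraic 𝐋 →
    (K : Pred (CompleteLattice.Carrier 𝐋) ℓ) →
    (∀ x → K x ⇔ IsCompact 𝐋 x) →
    (S : Pred (Maps² 𝐋) ℓ) → IsCompactParameterization 𝐋 K S →
    (Σ' : Pred (CompleteLattice.Carrier 𝐋 × CompleteLattice.Carrier 𝐋) ℓ) →
    (∀ {a b} → Σ' (a , b) → K a × K b) →
    ∀ a b → K a → K b →
    Derives 𝐋 K S Σ' a b ⇔ CompleteLattice._≤_ 𝐋 b (C 𝐋 K S Σ' a)
theorem16 𝐋 _ K K⇔compact S _ Σ' _ a b ka kb = mk⇔
  (λ a⇒b → ⋁-upper _ (kb , a , ka , ≤-refl , a⇒b))
  (λ b≤Ca → let ys , ys-consequences , b≤⋁ys = compact kb _ b≤Ca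
                k⋁ys = K-⋁-list K-⊥ K-∨ (All-map proj₁ ys-consequences)
            in ⇒-trans ka k⋁ys kb
                 (⇒-⋁-list K-⊥ K-∨ ka (All-map derivable ys-consequences))
                 (⇒-weaken k⋁ys kb b≤⋁ys))
  where
  open CompleteLattice 𝐋
  open IsPartialOrder isPartialOrder renaming (refl to ≤-refl)
  open JoinProperties 𝐋
  open CompactElements 𝐋
  open DerivedRules 𝐋 K S Σ'

  compact : ∀ {x} → K x → IsCompact 𝐋 x
  compact = Equivalence.to (K⇔compact _)

  K-⊥ : K (⋁-list [])
  K-⊥ = Equivalence.from (K⇔compact _) compact-⋁-list-[]

  K-∨ : ∀ {x y} → K x → K y → K (x ∨ y)
  K-∨ kx ky = Equivalence.from (K⇔compact _) (compact-∨ (compact kx) (compact ky))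

  derivable : ∀ {y} → K y × (∃ λ c → K c × c ≤ a × c ⇒ y) → K y × a ⇒ y
  derivable (ky , c , kc , c≤a , c⇒y) = ky , ⇒-trans ka kc ky (⇒-weaken ka kc c≤a) c⇒y
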